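{- Consider the online interval scheduling problem with satisfaction-based profits (as defined in the context) with $m = 2$ machines and arbitrary job profits. There does not exist any deterministic online algorithm whose competitive ratio is bounded.
   Context: There are $m$ identical machines. An input is a finite list of jobs; each job $J$ is a triple $(r(J), d(J), v(J))$ with release time $r(J)$, deadline $d(J) > r(J)$ and profit $v(J) > 0$. An algorithm assigns every job to one of the $m$ machines; any number of jobs may be assigned to the same machine and may overlap in time there. The profit of a job is distributed uniformly over its interval $[r(J), d(J)]$ and shared equally among the jobs on the same machine covering each point: if $J$ is on machine $a$ and $[r(J), d(J)]$ is split at all endpoints of intervals of jobs on machine $a$ into pieces $[x_i, x_{i+1}]$, $r(J) = x_1 < \dots < x_b = d(J)$, and $k_i$ is the number of jobs on machine $a$ whose intervals contain $(x_i, x_{i+1})$, then the algorithm gains $V(J) = \sum_{i=1}^{b-1} \frac{x_{i+1}-x_i}{d(J)-r(J)} \cdot \frac{v(J)}{k_i}$ from $J$; the profit of the algorithm on input $\sigma$ is the sum of $V(J)$ over all jobs, evaluated on the final schedule. In the online setting, jobs are revealed one at a time (not necessarily in order of release time), the total number of jobs is unknown, and each job must be irrevocably assigned to a machine before the next job is revealed (no preemption, no reassignment). An online algorithm $A$ is $c$-competitive (has competitive ratio at most $c$) if for every input $\sigma$ the profit of an optimal offline algorithm on $\sigma$ is at most $c$ times the profit of $A$ on $\sigma$. -}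

module Defs where

open import Data.Bool using (Bool; true; false; if_then_else_; _∧_; not)
open import Data.Nat as ℕ using (ℕ)
open import Data.Integer using (+_; +[1+_]; -[1+_])
open import Data.Fin as Fin using (Fin)
open import Data.List using (List; []; _∷_; _++_; [_]; map; zip; drop; filter; length; concatMap; foldr)
open import Data.Vec using (Vec; toList)
open import Data.Product using (_×_; _,_; proj₁; proj₂)
open import Data.Rational using (ℚ; mkℚ; 0ℚ; ½; _+_; _-_; _*_; _<_; _≤ᵇ_; 1/_)
open import Data.Rational.Properties using (≤-decTotalOrder)
open import Relation.Nullary using (does)
import Data.List.Sort.InsertionSort.Base as Sort

record Job : Set where
  constructor job
  field
    r     : ℚ
    d     : ℚ
    v     : ℚ
    r<d   : r < d
    v>0   : 0ℚ < v
open Job public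

Schedule : ℕ → Set
Schedule m = List (Job × Fin m)

_<ᵇ_ : ℚ → ℚ → Bool
p <ᵇ q = not (q ≤ᵇ p)

-- 1/p, with the (never used) convention 1/0 = 0.
inv : ℚ → ℚ
inv (mkℚ (+ 0) _ _) = 0ℚ
inv p@(mkℚ +[1+ _ ] _ _) = 1/ p
inv p@(mkℚ -[1+ _ ] _ _) = 1/ p

-- p / k for a natural number k, with p / 0 = 0 (only used for k ≥ 1).
divℕ : ℚ → ℕ → ℚ
divℕ p ℕ.zero = 0ℚ
divℕ p (ℕ.suc k) = p * (+ 1 Data.Rational./ ℕ.suc k)

sortℚ : List ℚ → List ℚ
sortℚ = Sort.sort ≤-decTotalOrder

module _ {m : ℕ} where

  jobsOn : Schedule m → Fin m → List Job
  jobsOn S a = map proj₁ (filter (λ p → proj₂ p Fin.≟ a) S)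

  -- number of jobs on machine a whose interval contains the point x in its interior
  -- (applied to the midpoint of a piece, this is k_i of the paper)
  cover : Schedule m → Fin m → ℚ → ℕ
  cover S a x = length (filter (λ J → Data.Bool._≟_ ((r J <ᵇ x) ∧ (x <ᵇ d J)) true) (jobsOn S a))

  endpoints : Schedule m → Fin m → List ℚ
  endpoints S a = sortℚ (concatMap (λ J → r J ∷ d J ∷ []) (jobsOn S a))

  pieces : Schedule m → Fin m → List (ℚ × ℚ)
  pieces S a = zip (endpoints S a) (drop 1 (endpoints S a))

  sumℚ : List ℚ → ℚ
  sumℚ = foldr _+_ 0ℚ

  gain : Schedule m → Job → Fin m → ℚ
  gain S J a =
    sumℚ (map (λ xy → if (r J ≤ᵇ proj₁ xy) ∧ (proj₂ xy ≤ᵇ d J)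
                      then divℕ ((proj₂ xy - proj₁ xy) * v J)
                                (cover S a ((proj₁ xy + proj₂ xy) * ½))
                      else 0ℚ)
              (pieces S a))
    * inv (d J - r J)

  profit : Schedule m → ℚ
  profit S = sumℚ (map (λ p → gain S (proj₁ p) (proj₂ p)) S)

  -- A deterministic online algorithm: given the jobs revealed so far (in order)
  -- and the new job, it irrevocably chooses a machine for the new job.
  OnlineAlg : Set
  OnlineAlg = List Job → Job → Fin m

  runFrom : OnlineAlg → List Job → List Job → Schedule m
  runFrom A hist [] = []
  runFrom A hist (J ∷ σ) = (J , A hist J) ∷ runFrom A (hist ++ [ J ]) σ

  run : OnlineAlg → List Job → Schedule m
  run A σ = runFrom A [] σ

  offline : (σ : List Job) → Vec (Fin m) (length σ) → Schedule m
  offline σ s = zip σ (toList s)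

module Submission where

-- The adversary only releases unit jobs, all with interval [0,1]. For them the
-- satisfaction-based gain is explicit: a unit job of profit w on a machine that
-- carries k unit jobs gains exactly w/k (derived below from the definition
-- of gain: sorted endpoints, pieces and covering numbers).
--
-- Given an algorithm A and a bound D ∈ ℕ, the adversary releases unit jobs
-- J₀, J₁, … with profits v_n = D·X_n + 1, where X_n = v₀ + … + v_{n-1}.
-- By pigeonhole, within 2D+1 steps some J_n is put on a machine that then
-- carries more than D jobs. Stopping right after J_n, the algorithm earns at
-- most X_n from the earlier jobs and at most v_n/(D+1) from J_n, so
-- D·ALG < 2·v_n; the offline schedule with J_n alone on the other machine
-- earns at least v_n. Taking D ≥ 2c gives c·ALG < OPT.

open import Defs
open import Data.Fin using (Fin)
open import Data.List using (List; length)
open import Data.Vec using (Vec)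
open import Data.Product using (∃-syntax)
open import Data.Rational using (ℚ; _*_; _<_)

open import Function using (_∘_)
open import Data.Bool using (true; if_then_else_; _∧_)
open import Data.Empty using (⊥-elim)
open import Data.Fin as F using (zero; suc)
open import Data.Nat as N using (ℕ; zero; suc; z≤n; s≤s)
import Data.Nat.Properties as NP
open import Algebra.Properties.CommutativeSemigroup NP.+-commutativeSemigroup using () renaming (interchange to +-interchange)
import Data.Nat.Coprimality as Coprime
open import Data.Integer as Z using (+_; -[1+_])
import Data.Integer.Properties as ZP
open import Data.Rational as Q using (mkℚ; 0ℚ; 1ℚ; ½; _+_; _-_; _≤_; _≤ᵇ_; ↥_; *≤*; 1/_)
import Data.Rational.Properties as QP
open import Data.List using ([]; _∷_; _++_; [_]; map; zip; drop; filter; replicate; concatMap)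
import Data.List.Properties as LP
open import Data.List.Relation.Unary.All using (All; []; _∷_)
import Data.List.Relation.Unary.All.Properties as AllP
import Data.List.Sort.InsertionSort.Base as Sort
open import Data.Vec using () renaming (_∷_ to _∷ᵥ_; [] to []ᵥ)
open import Data.Product using (_×_; _,_; proj₁; proj₂)
open import Data.Sum using (_⊎_; inj₁; inj₂)
open import Relation.Binary.PropositionalEquality hiding ([_])
open import Relation.Nullary using (Dec; yes; no)

0<1 : 0ℚ < 1ℚ
0<1 = QP.positive⁻¹ 1ℚ

unitJob : (w : ℚ) → 0ℚ < w → Job
unitJob w w>0 = job 0ℚ 1ℚ w 0<1 w>0

data IsUnit : Job → Set where
  isUnit : ∀ w w>0 → IsUnit (unitJob w w>0)

alternating : ℕ → List ℚ
alternating zero    = []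
alternating (suc k) = 0ℚ ∷ 1ℚ ∷ alternating k

unitEndpoints : (L : List Job) → All IsUnit L →
  concatMap (λ J → r J ∷ d J ∷ []) L ≡ alternating (length L)
unitEndpoints []      []                 = refl
unitEndpoints (_ ∷ L) (isUnit _ _ ∷ us) = cong (λ t → 0ℚ ∷ 1ℚ ∷ t) (unitEndpoints L us)

insert : ℚ → List ℚ → List ℚ
insert = Sort.insert QP.≤-decTotalOrder

insert-one : ∀ a b → insert 1ℚ (replicate a 0ℚ ++ replicate b 1ℚ) ≡ replicate a 0ℚ ++ replicate (suc b) 1ℚ
insert-one zero    zero    = refl
insert-one zero    (suc b) = refl
insert-one (suc a) b       = cong (0ℚ ∷_) (insert-one a b)

insert-zero : ∀ a b → insert 0ℚ (replicate a 0ℚ ++ replicate b 1ℚ) ≡ replicate (suc a) 0ℚ ++ replicate b 1ℚ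
insert-zero zero    zero    = refl
insert-zero zero    (suc b) = refl
insert-zero (suc a) b       = refl

sort-alternating : ∀ k → sortℚ (alternating k) ≡ replicate k 0ℚ ++ replicate k 1ℚ
sort-alternating zero    = refl
sort-alternating (suc k) = begin
  insert 0ℚ (insert 1ℚ (sortℚ (alternating k)))                    ≡⟨ cong (insert 0ℚ ∘ insert 1ℚ) (sort-alternating k) ⟩
  insert 0ℚ (insert 1ℚ (replicate k 0ℚ ++ replicate k 1ℚ))         ≡⟨ cong (insert 0ℚ) (insert-one k k) ⟩
  insert 0ℚ (replicate k 0ℚ ++ replicate (suc k) 1ℚ)               ≡⟨ insert-zero k (suc k) ⟩
  replicate (suc k) 0ℚ ++ replicate (suc k) 1ℚ                     ∎
  where open ≡-Reasoning

unitPieces : ℕ → List (ℚ × ℚ)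
unitPieces zero    = []
unitPieces (suc j) = replicate j (0ℚ , 0ℚ) ++ (0ℚ , 1ℚ) ∷ replicate j (1ℚ , 1ℚ)

zip-zeros : ∀ j (ys : List ℚ) →
  zip (0ℚ ∷ replicate j 0ℚ ++ ys) (replicate j 0ℚ ++ ys) ≡ replicate j (0ℚ , 0ℚ) ++ zip (0ℚ ∷ ys) ys
zip-zeros zero    ys = refl
zip-zeros (suc j) ys = cong ((0ℚ , 0ℚ) ∷_) (zip-zeros j ys)

zip-ones : ∀ j → zip (1ℚ ∷ replicate j 1ℚ) (replicate j 1ℚ) ≡ replicate j (1ℚ , 1ℚ)
zip-ones zero    = refl
zip-ones (suc j) = cong ((1ℚ , 1ℚ) ∷_) (zip-ones j)

consecutive-pairs : ∀ k → let e = replicate k 0ℚ ++ replicate k 1ℚ in zip e (drop 1 e) ≡ unitPieces k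
consecutive-pairs zero    = refl
consecutive-pairs (suc j) =
  trans (zip-zeros j (1ℚ ∷ replicate j 1ℚ))
        (cong (λ t → replicate j (0ℚ , 0ℚ) ++ (0ℚ , 1ℚ) ∷ t) (zip-ones j))

midpoint : ℚ
midpoint = (0ℚ + 1ℚ) * ½

module _ {m : ℕ} (S : Schedule m) (a : Fin m) (units : All IsUnit (jobsOn S a)) where

  piecesOfUnits : pieces S a ≡ unitPieces (length (jobsOn S a))
  piecesOfUnits =
    trans (cong (λ e → zip e (drop 1 e))
                (trans (cong sortℚ (unitEndpoints (jobsOn S a) units))
                       (sort-alternating (length (jobsOn S a)))))
          (consecutive-pairs (length (jobsOn S a)))

  coverOfUnits : cover S a midpoint ≡ length (jobsOn S a)
  coverOfUnits = coverList (jobsOn S a) units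
    where
    coverList : (L : List Job) → All IsUnit L →
      length (filter (λ J → Data.Bool._≟_ ((r J <ᵇ midpoint) ∧ (midpoint <ᵇ d J)) true) L) ≡ length L
    coverList []      []                 = refl
    coverList (_ ∷ L) (isUnit _ _ ∷ us) = cong suc (coverList L us)

pieceGain : {m : ℕ} → Schedule m → Job → Fin m → ℚ × ℚ → ℚ
pieceGain S J a xy =
  if (r J ≤ᵇ proj₁ xy) ∧ (proj₂ xy ≤ᵇ d J)
  then divℕ ((proj₂ xy - proj₁ xy) * v J) (cover S a ((proj₁ xy + proj₂ xy) * ½))
  else 0ℚ

-- A share of a zero profit is zero; this kills the degenerate pieces.
divℕ-zero : ∀ w k → divℕ (0ℚ * w) k ≡ 0ℚ
divℕ-zero w zero    = refl
divℕ-zero w (suc k) = trans (cong (_* (+ 1 Q./ suc k)) (QP.*-zeroˡ w)) (QP.*-zeroˡ (+ 1 Q./ suc k))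

sum-zeros-++ : ∀ {m} j ys → sumℚ {m} (replicate j 0ℚ ++ ys) ≡ sumℚ {m} ys
sum-zeros-++ zero    ys = refl
sum-zeros-++ {m} (suc j) ys = trans (cong (λ t → 0ℚ + t) (sum-zeros-++ {m} j ys)) (QP.+-identityˡ _)

sum-zeros-around : ∀ {m} j y → sumℚ {m} (replicate j 0ℚ ++ y ∷ replicate j 0ℚ) ≡ y
sum-zeros-around {m} j y = begin
  sumℚ {m} (replicate j 0ℚ ++ y ∷ replicate j 0ℚ)   ≡⟨ sum-zeros-++ {m} j (y ∷ replicate j 0ℚ) ⟩
  y + sumℚ {m} (replicate j 0ℚ)                     ≡⟨ cong (λ t → y + sumℚ {m} t) (sym (LP.++-identityʳ (replicate j 0ℚ))) ⟩
  y + sumℚ {m} (replicate j 0ℚ ++ [])               ≡⟨ cong (λ t → y + t) (sum-zeros-++ {m} j []) ⟩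
  y + 0ℚ                                            ≡⟨ QP.+-identityʳ y ⟩
  y                                                 ∎
  where open ≡-Reasoning

gainOfUnit : {m : ℕ} (S : Schedule m) (a : Fin m) → All IsUnit (jobsOn S a) →
  (w : ℚ) (w>0 : 0ℚ < w) → gain S (unitJob w w>0) a ≡ divℕ w (length (jobsOn S a))
gainOfUnit {m} S a units w w>0 =
  trans (cong (λ ps → sumℚ {m} (map g ps) * 1ℚ) (piecesOfUnits S a units))
        (sumPieces (length (jobsOn S a)) (coverOfUnits S a units))
  where
  g : ℚ × ℚ → ℚ
  g = pieceGain S (unitJob w w>0) a
  open ≡-Reasoning

  sumPieces : ∀ k → cover S a midpoint ≡ k → sumℚ {m} (map g (unitPieces k)) * 1ℚ ≡ divℕ w k
  sumPieces zero    _     = refl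
  sumPieces (suc j) cover≡ = begin
    sumℚ {m} (map g (replicate j (0ℚ , 0ℚ) ++ (0ℚ , 1ℚ) ∷ replicate j (1ℚ , 1ℚ))) * 1ℚ
      ≡⟨ QP.*-identityʳ _ ⟩
    sumℚ {m} (map g (replicate j (0ℚ , 0ℚ) ++ (0ℚ , 1ℚ) ∷ replicate j (1ℚ , 1ℚ)))
      ≡⟨ cong (sumℚ {m}) (LP.map-++ g (replicate j (0ℚ , 0ℚ)) _) ⟩
    sumℚ {m} (map g (replicate j (0ℚ , 0ℚ)) ++ g (0ℚ , 1ℚ) ∷ map g (replicate j (1ℚ , 1ℚ)))
      ≡⟨ cong₂ (λ xs ys → sumℚ {m} (xs ++ g (0ℚ , 1ℚ) ∷ ys))
               (trans (LP.map-replicate g j _) (cong (replicate j) (divℕ-zero w (cover S a ((0ℚ + 0ℚ) * ½)))))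
               (trans (LP.map-replicate g j _) (cong (replicate j) (divℕ-zero w (cover S a ((1ℚ + 1ℚ) * ½))))) ⟩
    sumℚ {m} (replicate j 0ℚ ++ g (0ℚ , 1ℚ) ∷ replicate j 0ℚ)
      ≡⟨ sum-zeros-around {m} j (g (0ℚ , 1ℚ)) ⟩
    divℕ (1ℚ * w) (cover S a midpoint)
      ≡⟨ cong₂ divℕ (QP.*-identityˡ w) cover≡ ⟩
    divℕ w (suc j) ∎

fromℕ : ℕ → ℚ
fromℕ n = mkℚ (+ n) 0 (Coprime.sym (Coprime.1-coprimeTo n))

fromℕ-mono : ∀ {m n} → m N.≤ n → fromℕ m ≤ fromℕ n
fromℕ-mono {m} {n} m≤n =
  *≤* (subst₂ Z._≤_ (sym (ZP.*-identityʳ (+ m))) (sym (ZP.*-identityʳ (+ n))) (Z.+≤+ m≤n))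

≤-fromℕ-∣↥∣ : (q : ℚ) → q ≤ fromℕ (Z.∣ ↥ q ∣)
≤-fromℕ-∣↥∣ (mkℚ (+ n) d-1 _) =
  *≤* (subst (Z._≤ (+ n Z.* + suc d-1)) (sym (ZP.*-identityʳ (+ n)))
             (subst (+ n Z.≤_) (ZP.pos-* n (suc d-1)) (Z.+≤+ (NP.m≤m*n n (suc d-1)))))
≤-fromℕ-∣↥∣ (mkℚ -[1+ n ] d-1 _) =
  *≤* (subst (Z._≤ (+ suc n Z.* + suc d-1)) (sym (ZP.*-identityʳ -[1+ n ])) Z.-≤+)

reciprocal : ∀ j → + 1 Q./ suc j ≡ 1/ fromℕ (suc j)
reciprocal j = QP.fromℚᵘ-toℚᵘ (mkℚ (+ 1) j (Coprime.1-coprimeTo (suc j)))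

reciprocal-nonNeg : ∀ j → 0ℚ ≤ + 1 Q./ suc j
reciprocal-nonNeg j = subst (0ℚ ≤_) (sym (reciprocal j)) (*≤* (Z.+≤+ z≤n))

reciprocal-≤-1 : ∀ j → + 1 Q./ suc j ≤ 1ℚ
reciprocal-≤-1 j = subst (_≤ 1ℚ) (sym (reciprocal j)) (*≤* (Z.+≤+ (s≤s z≤n)))

*-nonNeg : ∀ {p q} → 0ℚ ≤ p → 0ℚ ≤ q → 0ℚ ≤ p * q
*-nonNeg {p} {q} 0≤p 0≤q = subst (_≤ p * q) (QP.*-zeroʳ p) (QP.*-monoˡ-≤-nonNeg p {{Q.nonNegative 0≤p}} 0≤q)

divℕ-nonNeg : ∀ {w} → 0ℚ ≤ w → ∀ k → 0ℚ ≤ divℕ w k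
divℕ-nonNeg 0≤w zero    = QP.≤-refl
divℕ-nonNeg 0≤w (suc j) = *-nonNeg 0≤w (reciprocal-nonNeg j)

divℕ-≤ : ∀ {w} → 0ℚ ≤ w → ∀ k → divℕ w k ≤ w
divℕ-≤ 0≤w zero    = 0≤w
divℕ-≤ {w} 0≤w (suc j) =
  subst (w * (+ 1 Q./ suc j) ≤_) (QP.*-identityʳ w)
        (QP.*-monoˡ-≤-nonNeg w {{Q.nonNegative 0≤w}} (reciprocal-≤-1 j))

divℕ-cancel : ∀ w j → fromℕ (suc j) * divℕ w (suc j) ≡ w
divℕ-cancel w j = begin
  n * (w * (+ 1 Q./ suc j))   ≡⟨ cong (λ t → n * (w * t)) (reciprocal j) ⟩
  n * (w * n⁻¹)               ≡⟨ sym (QP.*-assoc n w n⁻¹) ⟩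
  (n * w) * n⁻¹               ≡⟨ cong (_* n⁻¹) (QP.*-comm n w) ⟩
  (w * n) * n⁻¹               ≡⟨ QP.*-assoc w n n⁻¹ ⟩
  w * (n * n⁻¹)               ≡⟨ cong (w *_) (QP.*-inverseʳ n) ⟩
  w * 1ℚ                      ≡⟨ QP.*-identityʳ w ⟩
  w                           ∎
  where
  n n⁻¹ : ℚ
  n   = fromℕ (suc j)
  n⁻¹ = 1/ n
  open ≡-Reasoning

-- If D ≤ k then D · (w/k) ≤ w: sharing among more than D jobs costs a factor D.
scaled-share-≤ : ∀ D k w → D N.≤ k → 0ℚ ≤ w → fromℕ D * divℕ w k ≤ w
scaled-share-≤ D zero    w _   0≤w = QP.≤-trans (QP.≤-reflexive (QP.*-zeroʳ (fromℕ D))) 0≤w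
scaled-share-≤ D (suc j) w D≤k 0≤w =
  subst (fromℕ D * divℕ w (suc j) ≤_) (divℕ-cancel w j)
        (QP.*-monoʳ-≤-nonNeg (divℕ w (suc j)) {{Q.nonNegative (divℕ-nonNeg 0≤w (suc j))}} (fromℕ-mono D≤k))

halve : ∀ {x y} → x + x < y + y → x < y
halve {x} {y} x+x<y+y with x Q.<? y
... | yes x<y = x<y
... | no  x≮y = ⊥-elim (QP.<-irrefl refl
  (QP.<-≤-trans x+x<y+y (QP.+-mono-≤ (QP.≮⇒≥ x≮y) (QP.≮⇒≥ x≮y))))

UnitSchedule : {m : ℕ} → Schedule m → Set
UnitSchedule S = All (IsUnit ∘ proj₁) S

unitJobsOn : {m : ℕ} (S : Schedule m) (a : Fin m) → UnitSchedule S → All IsUnit (jobsOn S a)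
unitJobsOn S a units = AllP.map⁺ (AllP.filter⁺ (λ p → proj₂ p F.≟ a) units)

gainIn : {m : ℕ} → Schedule m → Job × Fin m → ℚ
gainIn S p = gain S (proj₁ p) (proj₂ p)

gainInUnit : {m : ℕ} (S : Schedule m) → UnitSchedule S → (J : Job) (a : Fin m) → IsUnit J →
  gain S J a ≡ divℕ (v J) (length (jobsOn S a))
gainInUnit S units _ a (isUnit w w>0) = gainOfUnit S a (unitJobsOn S a units) w w>0

sumℚ-++ : ∀ {m} (xs ys : List ℚ) → sumℚ {m} (xs ++ ys) ≡ sumℚ {m} xs + sumℚ {m} ys
sumℚ-++ {m} []       ys = sym (QP.+-identityˡ (sumℚ {m} ys))
sumℚ-++ {m} (x ∷ xs) ys = trans (cong (λ t → x + t) (sumℚ-++ {m} xs ys)) (sym (QP.+-assoc x _ _))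

gains-snoc : ∀ {m} (S T : Schedule m) (x : Job × Fin m) →
  sumℚ {m} (map (gainIn S) (T ++ [ x ])) ≡ sumℚ {m} (map (gainIn S) T) + (gainIn S x + 0ℚ)
gains-snoc {m} S T x = trans (cong (sumℚ {m}) (LP.map-++ (gainIn S) T [ x ])) (sumℚ-++ {m} (map (gainIn S) T) [ gainIn S x ])

unit-profit-nonNeg : ∀ {J} → IsUnit J → 0ℚ ≤ v J
unit-profit-nonNeg (isUnit _ w>0) = QP.<⇒≤ w>0

module _ {m : ℕ} (S : Schedule m) (units : UnitSchedule S) where

  gains-nonNeg : (T : Schedule m) → UnitSchedule T → 0ℚ ≤ sumℚ {m} (map (gainIn S) T)
  gains-nonNeg []            []       = QP.≤-refl
  gains-nonNeg ((J , a) ∷ T) (u ∷ us) =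
    QP.+-mono-≤ (subst (0ℚ ≤_) (sym (gainInUnit S units J a u)) (divℕ-nonNeg (unit-profit-nonNeg u) (length (jobsOn S a))))
                (gains-nonNeg T us)

  gains-≤-profits : (T : Schedule m) → UnitSchedule T →
    sumℚ {m} (map (gainIn S) T) ≤ sumℚ {m} (map (v ∘ proj₁) T)
  gains-≤-profits []            []       = QP.≤-refl
  gains-≤-profits ((J , a) ∷ T) (u ∷ us) =
    QP.+-mono-≤ (subst (_≤ v J) (sym (gainInUnit S units J a u)) (divℕ-≤ (unit-profit-nonNeg u) (length (jobsOn S a))))
                (gains-≤-profits T us)

hit : Fin 2 → Fin 2 → ℕ
hit zero       zero       = 1
hit zero       (suc zero) = 0
hit (suc zero) zero       = 0
hit (suc zero) (suc zero) = 1

hit-other : ∀ b a → b ≢ a → hit b a ≡ 0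
hit-other zero       zero       b≢a = ⊥-elim (b≢a refl)
hit-other zero       (suc zero) _   = refl
hit-other (suc zero) zero       _   = refl
hit-other (suc zero) (suc zero) b≢a = ⊥-elim (b≢a refl)

hit-total : ∀ b → hit b zero N.+ hit b (suc zero) ≡ 1
hit-total zero       = refl
hit-total (suc zero) = refl

module Pigeonhole (choice : ℕ → Fin 2) (D : ℕ) where

  load : ℕ → Fin 2 → ℕ
  load zero    a = 0
  load (suc n) a = load n a N.+ hit (choice n) a

  load-total : ∀ n → load n zero N.+ load n (suc zero) ≡ n
  load-total zero    = refl
  load-total (suc n) = begin
    (l₀ N.+ h₀) N.+ (l₁ N.+ h₁)   ≡⟨ +-interchange l₀ h₀ l₁ h₁ ⟩
    (l₀ N.+ l₁) N.+ (h₀ N.+ h₁)   ≡⟨ cong₂ N._+_ (load-total n) (hit-total (choice n)) ⟩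
    n N.+ 1                        ≡⟨ NP.+-comm n 1 ⟩
    suc n                          ∎
    where
    l₀ l₁ h₀ h₁ : ℕ
    l₀ = load n zero
    l₁ = load n (suc zero)
    h₀ = hit (choice n) zero
    h₁ = hit (choice n) (suc zero)
    open ≡-Reasoning

  Overload : Set
  Overload = ∃[ n ] D N.< load (suc n) (choice n)

  Bounded : ℕ → Set
  Bounded n = ∀ a → load n a N.≤ D

  -- Only the load of the chosen machine grows.
  bounded-step : ∀ n → Bounded n → load (suc n) (choice n) N.≤ D → Bounded (suc n)
  bounded-step n bounded chosen≤D a with choice n F.≟ a
  ... | yes refl = chosen≤D
  ... | no  b≢a  = subst (N._≤ D) (sym (trans (cong (load n a N.+_) (hit-other (choice n) a b≢a)) (NP.+-identityʳ _)))
                         (bounded a)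

  overload-or-bounded : ∀ n → Overload ⊎ Bounded n
  overload-or-bounded zero    = inj₂ (λ _ → z≤n)
  overload-or-bounded (suc n) with overload-or-bounded n
  ... | inj₁ overload = inj₁ overload
  ... | inj₂ bounded with D N.<? load (suc n) (choice n)
  ...   | yes over = inj₁ (n , over)
  ...   | no  ¬over = inj₂ (bounded-step n bounded (NP.≮⇒≥ ¬over))

  -- Both loads are at most D only while fewer than 2D+1 jobs were placed.
  pigeonhole : Overload
  pigeonhole with overload-or-bounded (suc (D N.+ D))
  ... | inj₁ overload = overload
  ... | inj₂ bounded  = ⊥-elim (NP.<⇒≱ (NP.n<1+n (D N.+ D))
          (subst (N._≤ D N.+ D) (load-total (suc (D N.+ D))) (NP.+-mono-≤ (bounded zero) (bounded (suc zero)))))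

module _ {m : ℕ} (A : OnlineAlg {m}) where

  run-snoc : (h xs : List Job) (J : Job) →
    runFrom A h (xs ++ [ J ]) ≡ runFrom A h xs ++ [ (J , A (h ++ xs) J) ]
  run-snoc h []       J = cong (λ h′ → [ (J , A h′ J) ]) (sym (LP.++-identityʳ h))
  run-snoc h (y ∷ xs) J = cong ((y , A h y) ∷_) (begin
    runFrom A (h ++ [ y ]) (xs ++ [ J ])
      ≡⟨ run-snoc (h ++ [ y ]) xs J ⟩
    runFrom A (h ++ [ y ]) xs ++ [ (J , A ((h ++ [ y ]) ++ xs) J) ]
      ≡⟨ cong (λ h′ → runFrom A (h ++ [ y ]) xs ++ [ (J , A h′ J) ]) (LP.++-assoc h [ y ] xs) ⟩
    runFrom A (h ++ [ y ]) xs ++ [ (J , A (h ++ y ∷ xs) J) ] ∎)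
    where open ≡-Reasoning

  run-jobs : (h σ : List Job) → map proj₁ (runFrom A h σ) ≡ σ
  run-jobs h []      = refl
  run-jobs h (J ∷ σ) = cong (J ∷_) (run-jobs (h ++ [ J ]) σ)

  run-units : (σ : List Job) → All IsUnit σ → UnitSchedule (run A σ)
  run-units σ units = AllP.map⁻ (subst (All IsUnit) (sym (run-jobs [] σ)) units)

load-snoc : (S : Schedule 2) (J : Job) (b a : Fin 2) →
  length (jobsOn (S ++ [ (J , b) ]) a) ≡ length (jobsOn S a) N.+ hit b a
load-snoc S J b a = begin
  length (map proj₁ (filter P? (S ++ [ (J , b) ])))
    ≡⟨ cong (length ∘ map proj₁) (LP.filter-++ P? S [ (J , b) ]) ⟩
  length (map proj₁ (filter P? S ++ filter P? [ (J , b) ]))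
    ≡⟨ cong length (LP.map-++ proj₁ (filter P? S) _) ⟩
  length (jobsOn S a ++ jobsOn [ (J , b) ] a)
    ≡⟨ LP.length-++ (jobsOn S a) ⟩
  length (jobsOn S a) N.+ length (jobsOn [ (J , b) ] a)
    ≡⟨ cong (length (jobsOn S a) N.+_) (singleLoad b a) ⟩
  length (jobsOn S a) N.+ hit b a ∎
  where
  P? : (p : Job × Fin 2) → Dec (proj₂ p ≡ a)
  P? p = proj₂ p F.≟ a
  open ≡-Reasoning
  singleLoad : ∀ b a → length (jobsOn [ (J , b) ] a) ≡ hit b a
  singleLoad zero       zero       = refl
  singleLoad zero       (suc zero) = refl
  singleLoad (suc zero) zero       = refl
  singleLoad (suc zero) (suc zero) = refl

isolateLast : (xs : List Job) (x : Job) → Vec (Fin 2) (length (xs ++ [ x ]))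
isolateLast []       x = suc zero ∷ᵥ []ᵥ
isolateLast (_ ∷ xs) x = zero ∷ᵥ isolateLast xs x

onFirst : Job → Job × Fin 2
onFirst J = (J , zero)

isolateLast-schedule : (xs : List Job) (x : Job) →
  offline (xs ++ [ x ]) (isolateLast xs x) ≡ map onFirst xs ++ [ (x , suc zero) ]
isolateLast-schedule []       x = refl
isolateLast-schedule (y ∷ xs) x = cong ((y , zero) ∷_) (isolateLast-schedule xs x)

isolated : (xs : List Job) (x : Job) → length (jobsOn (map onFirst xs ++ [ (x , suc zero) ]) (suc zero)) ≡ 1
isolated []       x = refl
isolated (_ ∷ xs) x = isolated xs x

isolateLast-profit : (xs : List Job) (x : Job) → All IsUnit xs → IsUnit x →
  v x ≤ profit (offline (xs ++ [ x ]) (isolateLast xs x))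
isolateLast-profit xs x units unit = subst₂ _≤_ cleanup (sym profit≡)
  (QP.+-mono-≤ (gains-nonNeg O unitsO (map onFirst xs) unitsFirst)
               (QP.≤-reflexive (cong (_+ 0ℚ) (sym lastGain))))
  where
  O : Schedule 2
  O = map onFirst xs ++ [ (x , suc zero) ]
  unitsFirst : UnitSchedule (map onFirst xs)
  unitsFirst = AllP.map⁺ units
  unitsO : UnitSchedule O
  unitsO = AllP.++⁺ unitsFirst (unit ∷ [])
  profit≡ : profit (offline (xs ++ [ x ]) (isolateLast xs x))
          ≡ sumℚ {2} (map (gainIn O) (map onFirst xs)) + (gainIn O (x , suc zero) + 0ℚ)
  profit≡ = trans (cong profit (isolateLast-schedule xs x)) (gains-snoc O (map onFirst xs) (x , suc zero))
  lastGain : gainIn O (x , suc zero) ≡ v x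
  lastGain = trans (gainInUnit O unitsO x (suc zero) unit)
                   (trans (cong (divℕ (v x)) (isolated xs x)) (QP.*-identityʳ (v x)))
  cleanup : 0ℚ + (v x + 0ℚ) ≡ v x
  cleanup = trans (QP.+-identityˡ _) (QP.+-identityʳ _)

module Adversary (A : OnlineAlg {2}) (D : ℕ) where

  X : ℕ → ℚ
  value : ℕ → ℚ
  X zero    = 0ℚ
  X (suc n) = X n + value n
  value n = fromℕ D * X n + 1ℚ

  D-nonNeg : 0ℚ ≤ fromℕ D
  D-nonNeg = fromℕ-mono z≤n

  X-nonNeg : ∀ n → 0ℚ ≤ X n
  value>0 : ∀ n → 0ℚ < value n
  X-nonNeg zero    = QP.≤-refl
  X-nonNeg (suc n) = QP.+-mono-≤ (X-nonNeg n) (QP.<⇒≤ (value>0 n))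
  value>0 n = QP.+-mono-≤-< (*-nonNeg D-nonNeg (X-nonNeg n)) 0<1

  adversaryJob : ℕ → Job
  adversaryJob n = unitJob (value n) (value>0 n)

  revealed : ℕ → List Job
  revealed zero    = []
  revealed (suc n) = revealed n ++ [ adversaryJob n ]

  revealed-units : ∀ n → All IsUnit (revealed n)
  revealed-units zero    = []
  revealed-units (suc n) = AllP.++⁺ (revealed-units n) (isUnit _ _ ∷ [])

  revealed-profits : ∀ n → sumℚ {2} (map v (revealed n)) ≡ X n
  revealed-profits zero    = refl
  revealed-profits (suc n) = begin
    sumℚ {2} (map v (revealed n ++ [ adversaryJob n ]))     ≡⟨ cong (sumℚ {2}) (LP.map-++ v (revealed n) _) ⟩
    sumℚ {2} (map v (revealed n) ++ [ value n ])            ≡⟨ sumℚ-++ {2} (map v (revealed n)) _ ⟩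
    sumℚ {2} (map v (revealed n)) + (value n + 0ℚ)          ≡⟨ cong₂ _+_ (revealed-profits n) (QP.+-identityʳ _) ⟩
    X n + value n                                           ∎
    where open ≡-Reasoning

  choice : ℕ → Fin 2
  choice n = A (revealed n) (adversaryJob n)

  schedule : ℕ → Schedule 2
  schedule n = run A (revealed n)

  schedule-units : ∀ n → UnitSchedule (schedule n)
  schedule-units n = run-units A (revealed n) (revealed-units n)

  schedule-snoc : ∀ n → schedule (suc n) ≡ schedule n ++ [ (adversaryJob n , choice n) ]
  schedule-snoc n = run-snoc A [] (revealed n) (adversaryJob n)

  open Pigeonhole choice D using (load; pigeonhole)

  machine-load : ∀ n a → length (jobsOn (schedule n) a) ≡ load n a
  machine-load zero    a = refl
  machine-load (suc n) a = begin
    length (jobsOn (schedule (suc n)) a)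
      ≡⟨ cong (λ S → length (jobsOn S a)) (schedule-snoc n) ⟩
    length (jobsOn (schedule n ++ [ (adversaryJob n , choice n) ]) a)
      ≡⟨ load-snoc (schedule n) (adversaryJob n) (choice n) a ⟩
    length (jobsOn (schedule n) a) N.+ hit (choice n) a
      ≡⟨ cong (N._+ hit (choice n) a) (machine-load n a) ⟩
    load (suc n) a ∎
    where open ≡-Reasoning

  online : ℕ → ℚ
  online n = profit (schedule (suc n))

  online-nonNeg : ∀ n → 0ℚ ≤ online n
  online-nonNeg n = gains-nonNeg (schedule (suc n)) (schedule-units (suc n)) (schedule (suc n)) (schedule-units (suc n))

  -- If the n-th job lands on a machine then carrying k > D jobs, then
  -- D·ALG < 2·v_n: the earlier jobs earn at most X n, and the n-th job earns
  -- v_n/k with D·(v_n/k) ≤ v_n, while D·X n < v_n.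
  online-bound : ∀ n → D N.< length (jobsOn (schedule (suc n)) (choice n)) →
    fromℕ D * online n < value n + value n
  online-bound n overloaded = begin-strict
    fromℕ D * online n
      ≡⟨ cong (fromℕ D *_) (trans (cong (λ T → sumℚ {2} (map (gainIn S) T)) (schedule-snoc n))
                                  (gains-snoc S (schedule n) (adversaryJob n , choice n))) ⟩
    fromℕ D * (earlier + (last + 0ℚ))
      ≡⟨ QP.*-distribˡ-+ (fromℕ D) earlier (last + 0ℚ) ⟩
    fromℕ D * earlier + fromℕ D * (last + 0ℚ)
      ≤⟨ QP.+-mono-≤ (QP.*-monoˡ-≤-nonNeg (fromℕ D) {{Q.nonNegative D-nonNeg}} earlier≤X) last-share ⟩
    fromℕ D * X n + value n
      <⟨ QP.+-mono-<-≤ DX<value QP.≤-refl ⟩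
    value n + value n ∎
    where
    open QP.≤-Reasoning
    S : Schedule 2
    S = schedule (suc n)
    k : ℕ
    k = length (jobsOn S (choice n))
    earlier last : ℚ
    earlier = sumℚ {2} (map (gainIn S) (schedule n))
    last = gainIn S (adversaryJob n , choice n)
    earlier≤X : earlier ≤ X n
    earlier≤X = subst (earlier ≤_)
      (trans (cong (sumℚ {2}) (trans (LP.map-∘ (schedule n)) (cong (map v) (run-jobs A [] (revealed n)))))
             (revealed-profits n))
      (gains-≤-profits S (schedule-units (suc n)) (schedule n) (schedule-units n))
    DX<value : fromℕ D * X n < value n
    DX<value = subst (_< value n) (QP.+-identityʳ (fromℕ D * X n)) (QP.+-mono-≤-< (QP.≤-refl {fromℕ D * X n}) 0<1)
    last-share : fromℕ D * (last + 0ℚ) ≤ value n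
    last-share = subst (λ z → fromℕ D * z ≤ value n)
      (sym (trans (QP.+-identityʳ last) (gainInUnit S (schedule-units (suc n)) (adversaryJob n) (choice n) (isUnit (value n) (value>0 n)))))
      (scaled-share-≤ D k (value n) (NP.<⇒≤ overloaded) (QP.<⇒≤ (value>0 n)))

  overloaded-round : ∃[ n ] D N.< length (jobsOn (schedule (suc n)) (choice n))
  overloaded-round =
    proj₁ pigeonhole ,
    subst (D N.<_) (sym (machine-load (suc (proj₁ pigeonhole)) (choice (proj₁ pigeonhole)))) (proj₂ pigeonhole)

  offline-bound : ∀ n → value n ≤ profit (offline (revealed (suc n)) (isolateLast (revealed n) (adversaryJob n)))
  offline-bound n = isolateLast-profit (revealed n) (adversaryJob n) (revealed-units n) (isUnit _ _)

-- With D = |numerator of 2c| ≥ 2c, stopping at an overloaded round gives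
-- 2c·ALG ≤ D·ALG < 2·v_n ≤ 2·OPT, hence c·ALG < OPT.
mainTheorem1 : (A : OnlineAlg {2}) (c : ℚ) →
    ∃[ σ ] ∃[ s ] (c * profit (run A σ) < profit (offline {2} σ s))
mainTheorem1 A c = revealed (suc n) , isolateLast (revealed n) (adversaryJob n) , halve 2c·ALG<2·OPT
  where
  D : ℕ
  D = Z.∣ ↥ (c + c) ∣
  open Adversary A D
  n : ℕ
  n = proj₁ overloaded-round
  ALG OPT : ℚ
  ALG = online n
  OPT = profit (offline (revealed (suc n)) (isolateLast (revealed n) (adversaryJob n)))
  2c·ALG<2·OPT : c * ALG + c * ALG < OPT + OPT
  2c·ALG<2·OPT = begin-strict
    c * ALG + c * ALG   ≡⟨ QP.*-distribʳ-+ ALG c c ⟨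
    (c + c) * ALG       ≤⟨ QP.*-monoʳ-≤-nonNeg ALG {{Q.nonNegative (online-nonNeg n)}} (≤-fromℕ-∣↥∣ (c + c)) ⟩
    fromℕ D * ALG       <⟨ online-bound n (proj₂ overloaded-round) ⟩
    value n + value n   ≤⟨ QP.+-mono-≤ (offline-bound n) (offline-bound n) ⟩
    OPT + OPT           ∎
    where open QP.≤-Reasoning
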